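{- For every $n\ge0$, the number $\mathit{pnw}(n)$ of prefix normal words of length $n$ satisfies $\mathit{pnw}(n)\ge2^{\lfloor n/2\rfloor}$. In particular, $\mathit{pnw}(n)$ grows exponentially in $n$.
   Context: A binary word $w$ of length $n$ is prefix normal if, for every $1\le k\le n$, no substring of $w$ of length $k$ contains more $1$s than the prefix of $w$ of length $k$. -}

module Defs where

open import Data.Bool using (Bool; true; false)
open import Data.Nat using (ℕ; zero; suc; _+_; _≤_; _≤?_)
open import Data.Fin using (Fin; toℕ)
open import Data.Fin.Properties using (all?)
open import Data.List using (List; []; _∷_; take; drop; length; filter; map; _++_)
open import Data.Vec using (Vec; toList) renaming ([] to []ᵥ; _∷_ to _∷ᵥ_)
open import Relation.Nullary using (Dec)
open import Relation.Nullary.Decidable using (_→-dec_)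
open import Relation.Unary using (Decidable)

ones : List Bool → ℕ
ones [] = 0
ones (true ∷ w) = suc (ones w)
ones (false ∷ w) = ones w

PrefixNormal : {n : ℕ} → Vec Bool n → Set
PrefixNormal {n} v =
  (k : Fin (suc n)) (i : Fin (suc n)) →
  toℕ i + toℕ k ≤ n →
  ones (take (toℕ k) (drop (toℕ i) (toList v))) ≤ ones (take (toℕ k) (toList v))

prefixNormal? : {n : ℕ} → Decidable (PrefixNormal {n})
prefixNormal? {n} v =
  all? λ k → all? λ i →
    (toℕ i + toℕ k ≤? n) →-dec
    (ones (take (toℕ k) (drop (toℕ i) (toList v))) ≤? ones (take (toℕ k) (toList v)))

words : (n : ℕ) → List (Vec Bool n)
words zero = []ᵥ ∷ []
words (suc n) = map (true ∷ᵥ_) (words n) ++ map (false ∷ᵥ_) (words n)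

pnw : ℕ → ℕ
pnw n = length (filter prefixNormal? (words n))

-- Prefixing any word of length k by a block of m ≥ k ones gives a prefix normal
-- word: a window of length at most m is beaten by the all-ones prefix, and a
-- longer window starting at position i loses m − i ones of the block and can gain
-- at most i ones in the tail. Hence pnw (m + k) ≥ 2 ^ k; take k = ⌊n/2⌋, m = ⌈n/2⌉.
module Submission where

open import Defs
open import Data.Nat using (ℕ; _≤_; _^_; _/_; zero; suc; _+_; _∸_; z≤n; s≤s; ⌊_/2⌋; ⌈_/2⌉)
open import Data.Nat.Properties
open import Data.Nat.DivMod using (m/n≡1+[m∸n]/n)
open import Data.Bool using (Bool; true; false)
open import Data.List using (List; []; _∷_; take; drop; length; filter; map; replicate; _++_)
open import Data.List.Properties using (length-map; length-++; length-replicate; filter-all; map-∘; map-id)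
open import Data.List.Relation.Unary.All as All using (All)
open import Data.List.Relation.Unary.All.Properties using (map⁺)
open import Data.List.Relation.Binary.Sublist.Propositional using (_⊆_; ⊆-reflexive; ⊆-trans)
open import Data.List.Relation.Binary.Sublist.Propositional.Properties
  using (length-mono-≤; filter⁺; ++⁺ʳ)
  renaming (map⁺ to ⊆-map⁺)
open import Data.Vec as Vec using (Vec; toList)
open import Data.Vec.Properties using (toList-++; toList-replicate; length-toList)
open import Data.Fin using (toℕ)
open import Data.Product using (_,_)
open import Data.Sum using (inj₁; inj₂)
open import Function using (_∘_)
open import Algebra.Properties.CommutativeSemigroup +-commutativeSemigroup using (x∙yz≈y∙xz)
open import Level using (Level)
open import Relation.Unary using (Pred; Decidable)
open import Relation.Binary.PropositionalEquality

private
  variable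
    a p : Level

All-⊆⇒length≤length-filter : {A : Set a} {P : Pred A p} (P? : Decidable P) {xs ys : List A} →
  All P xs → xs ⊆ ys → length xs ≤ length (filter P? ys)
All-⊆⇒length≤length-filter P? {xs} {ys} all-P xs⊆ys = begin
  length xs              ≡⟨ cong length (sym (filter-all P? all-P)) ⟩
  length (filter P? xs)  ≤⟨ length-mono-≤ (filter⁺ P? P? (λ { refl px → px }) xs⊆ys) ⟩
  length (filter P? ys)  ∎
  where open ≤-Reasoning

ones-take-≤ : ∀ a xs → ones (take a xs) ≤ a
ones-take-≤ zero xs = z≤n
ones-take-≤ (suc a) [] = z≤n
ones-take-≤ (suc a) (true ∷ xs) = s≤s (ones-take-≤ a xs)
ones-take-≤ (suc a) (false ∷ xs) = m≤n⇒m≤1+n (ones-take-≤ a xs)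

ones-take-+ : ∀ j i xs → ones (take (j + i) xs) ≤ ones (take j xs) + i
ones-take-+ zero i xs = ones-take-≤ i xs
ones-take-+ (suc j) i [] = z≤n
ones-take-+ (suc j) i (true ∷ xs) = s≤s (ones-take-+ j i xs)
ones-take-+ (suc j) i (false ∷ xs) = ones-take-+ j i xs

ones-take-block : ∀ {a m} u → a ≤ m → ones (take a (replicate m true ++ u)) ≡ a
ones-take-block u z≤n = refl
ones-take-block u (s≤s a≤m) = cong suc (ones-take-block u a≤m)

ones-take-block-+ : ∀ m j u → ones (take (m + j) (replicate m true ++ u)) ≡ m + ones (take j u)
ones-take-block-+ zero j u = refl
ones-take-block-+ (suc m) j u = cong suc (ones-take-block-+ m j u)

drop-block : ∀ {i m} u → i ≤ m → drop i (replicate m true ++ u) ≡ replicate (m ∸ i) true ++ u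
drop-block u z≤n = refl
drop-block u (s≤s i≤m) = drop-block u i≤m

block-window-≤ : ∀ {i m} j u → i ≤ m →
  ones (take (m + j) (drop i (replicate m true ++ u))) ≤ ones (take (m + j) (replicate m true ++ u))
block-window-≤ {i} {m} j u i≤m = begin
  ones (take (m + j) (drop i (replicate m true ++ u)))
    ≡⟨ cong (ones ∘ take (m + j)) (drop-block u i≤m) ⟩
  ones (take (m + j) (replicate (m ∸ i) true ++ u))
    ≡⟨ cong (λ l → ones (take l (replicate (m ∸ i) true ++ u))) (sym ([m∸i]+[x+i]≡m+x j)) ⟩
  ones (take ((m ∸ i) + (j + i)) (replicate (m ∸ i) true ++ u))
    ≡⟨ ones-take-block-+ (m ∸ i) (j + i) u ⟩
  (m ∸ i) + ones (take (j + i) u)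
    ≤⟨ +-monoʳ-≤ (m ∸ i) (ones-take-+ j i u) ⟩
  (m ∸ i) + (ones (take j u) + i)
    ≡⟨ [m∸i]+[x+i]≡m+x (ones (take j u)) ⟩
  m + ones (take j u)
    ≡⟨ sym (ones-take-block-+ m j u) ⟩
  ones (take (m + j) (replicate m true ++ u)) ∎
  where
  open ≤-Reasoning
  [m∸i]+[x+i]≡m+x : ∀ x → (m ∸ i) + (x + i) ≡ m + x
  [m∸i]+[x+i]≡m+x x = trans (x∙yz≈y∙xz (m ∸ i) x i) (trans (cong (x +_) (m∸n+n≡m i≤m)) (+-comm x m))

IsPrefixNormal : List Bool → Set
IsPrefixNormal w = ∀ a i → i + a ≤ length w → ones (take a (drop i w)) ≤ ones (take a w)

block-prefixNormal : ∀ m u → length u ≤ m → IsPrefixNormal (replicate m true ++ u)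
block-prefixNormal m u u≤m a i fits with ≤-total a m
... | inj₁ a≤m = ≤-trans (ones-take-≤ a _) (≤-reflexive (sym (ones-take-block u a≤m)))
... | inj₂ m≤a with m≤n⇒∃[o]m+o≡n m≤a
...   | j , refl = block-window-≤ j u (≤-trans (m≤m+n i j) (≤-trans i+j≤|u| u≤m))
  where
  i+j≤|u| : i + j ≤ length u
  i+j≤|u| = +-cancelˡ-≤ m (i + j) (length u) (begin
    m + (i + j)                          ≡⟨ x∙yz≈y∙xz m i j ⟩
    i + (m + j)                          ≤⟨ fits ⟩
    length (replicate m true ++ u)       ≡⟨ length-++ (replicate m true) ⟩
    length (replicate m true) + length u ≡⟨ cong (_+ length u) (length-replicate m) ⟩
    m + length u                         ∎)
    where open ≤-Reasoning

toList-prefixNormal : ∀ {n} (v : Vec Bool n) → IsPrefixNormal (toList v) → PrefixNormal v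
toList-prefixNormal v pn k i fits = pn (toℕ k) (toℕ i) (subst (_ ≤_) (sym (length-toList v)) fits)

padded : ∀ m {k} → Vec Bool k → Vec Bool (m + k)
padded m v = Vec.replicate m true Vec.++ v

padded-prefixNormal : ∀ {m k} → k ≤ m → (v : Vec Bool k) → PrefixNormal (padded m v)
padded-prefixNormal {m} k≤m v = toList-prefixNormal (padded m v)
  (subst IsPrefixNormal (sym toList-padded)
    (block-prefixNormal m (toList v) (subst (_≤ m) (sym (length-toList v)) k≤m)))
  where
  toList-padded : toList (padded m v) ≡ replicate m true ++ toList v
  toList-padded = trans (toList-++ (Vec.replicate m true) v)
                        (cong (_++ toList v) (toList-replicate m true))

length-words : ∀ k → length (words k) ≡ 2 ^ k
length-words zero = refl
length-words (suc k) = begin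
  length (map (true Vec.∷_) (words k) ++ map (_ Vec.∷_) (words k))
    ≡⟨ length-++ (map (true Vec.∷_) (words k)) ⟩
  length (map _ (words k)) + length (map _ (words k))
    ≡⟨ cong₂ _+_ (length-map _ (words k)) (length-map _ (words k)) ⟩
  length (words k) + length (words k)
    ≡⟨ cong (λ l → l + l) (length-words k) ⟩
  2 ^ k + 2 ^ k
    ≡⟨ cong (2 ^ k +_) (sym (+-identityʳ (2 ^ k))) ⟩
  2 ^ suc k ∎
  where open ≡-Reasoning

padded-words-⊆ : ∀ m k → map (padded m) (words k) ⊆ words (m + k)
padded-words-⊆ zero k = ⊆-reflexive (map-id (words k))
padded-words-⊆ (suc m) k = ++⁺ʳ _ (⊆-trans (⊆-reflexive (map-∘ (words k)))
                                            (⊆-map⁺ (true Vec.∷_) (padded-words-⊆ m k)))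

pnw-≥ : ∀ {m k} → k ≤ m → 2 ^ k ≤ pnw (m + k)
pnw-≥ {m} {k} k≤m = begin
  2 ^ k                          ≡⟨ sym (length-words k) ⟩
  length (words k)               ≡⟨ sym (length-map (padded m) (words k)) ⟩
  length (map (padded m) (words k))
    ≤⟨ All-⊆⇒length≤length-filter prefixNormal?
         (map⁺ (All.universal (padded-prefixNormal k≤m) (words k))) (padded-words-⊆ m k) ⟩
  pnw (m + k)                    ∎
  where open ≤-Reasoning

n/2≡⌊n/2⌋ : ∀ n → n / 2 ≡ ⌊ n /2⌋
n/2≡⌊n/2⌋ zero = refl
n/2≡⌊n/2⌋ (suc zero) = refl
n/2≡⌊n/2⌋ (suc (suc n)) = trans (m/n≡1+[m∸n]/n {suc (suc n)} (s≤s (s≤s z≤n))) (cong suc (n/2≡⌊n/2⌋ n))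

lemma4 : (n : ℕ) → 2 ^ (n / 2) ≤ pnw n
lemma4 n rewrite n/2≡⌊n/2⌋ n =
  subst (λ l → 2 ^ ⌊ n /2⌋ ≤ pnw l)
        (trans (+-comm ⌈ n /2⌉ ⌊ n /2⌋) (⌊n/2⌋+⌈n/2⌉≡n n))
        (pnw-≥ (⌊n/2⌋≤⌈n/2⌉ n))
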